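{- Consider an instance of the Bin Packing with Usage Cost problem: $n$ items with positive integer sizes $w_1\le\dots\le w_n$, total size $W=\sum_{i=1}^n w_i$, and $m$ bins where bin $j$ has positive integer capacity $C_j$, non-negative fixed cost $f_j$ and non-negative unit cost $c_j$. Assume $\sum_{j=1}^m C_j\ge W$. Let $r_j=f_j/C_j+c_j$ and let $a_1,\dots,a_m$ be a permutation of $\{1,\dots,m\}$ with $r_{a_1}\le \dots\le r_{a_m}$. Let $k$ be the minimum number such that $\sum_{j=1}^k C_{a_j}\ge W$, and define $$Lb_1=\sum_{j=1}^{k-1} C_{a_j}r_{a_j}+\Big(W-\sum_{j=1}^{k-1}C_{a_j}\Big)r_{a_k}.$$ Then $Lb_1$ equals the optimal value of the linear programming relaxation (replacing $x_{ij}\in\{0,1\}$, $y_j\in\{0,1\}$ with $0\le x_{ij}\le 1$, $0\le y_j\le 1$) of the integer program $$\min \sum_{j=1}^m (f_jy_j+c_jl_j)$$ subject to $\sum_{j=1}^m x_{ij}=1$ for all $i\in\{1,\dots,n\}$; $\sum_{i=1}^n w_ix_{ij}=l_j$ for all $j\in\{1,\dots,m\}$; $l_j\le C_jy_j$ for all $j$; $x_{ij}\in\{0,1\}$, $y_j\in\{0,1\}$, $l_j\ge 0$.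
   Context: In the Bin Packing with Usage Cost problem, each item must be assigned to exactly one bin without exceeding bin capacities; a used bin $j$ (one containing at least one item) with load $l_j$ costs $f_j+c_jl_j$, and total cost is minimised. In the integer program, $x_{ij}=1$ iff item $i$ is in bin $j$, $y_j=1$ iff bin $j$ is used, and $l_j$ is the load of bin $j$.
   Formalization: The costs $f_j$, $c_j$ and the relaxation variables $x_{ij}$, $y_j$, $l_j$ are taken in ℚ rather than in the reals. -}

module Defs where

open import Data.Nat as ℕ using (ℕ; zero; suc; NonZero)
open import Data.Fin using (Fin; zero; suc; toℕ)
open import Data.List using (List; map; take; allFin; foldr)
open import Data.Integer using (+_)
open import Data.Rational using (ℚ; 0ℚ; 1ℚ; _+_; _*_; _-_; _/_; _≤_)
open import Data.Product using (_×_)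

ℕtoℚ : ℕ → ℚ
ℕtoℚ n = (+ n) / 1

Σℚ : ∀ {n} → (Fin n → ℚ) → ℚ
Σℚ {zero} f = 0ℚ
Σℚ {suc n} f = f zero + Σℚ (λ i → f (suc i))

Σℕ : ∀ {n} → (Fin n → ℕ) → ℕ
Σℕ {zero} f = 0
Σℕ {suc n} f = f zero ℕ.+ Σℕ (λ i → f (suc i))

sumListℚ : ∀ {A : Set} → (A → ℚ) → List A → ℚ
sumListℚ g = foldr (λ a s → g a + s) 0ℚ

sumListℕ : ∀ {A : Set} → (A → ℕ) → List A → ℕ
sumListℕ g = foldr (λ a s → g a ℕ.+ s) 0

rate : ∀ {m} (C : Fin m → ℕ) → (∀ j → NonZero (C j)) → (f c : Fin m → ℚ) → Fin m → ℚ
rate C Cpos f c j = f j * _/_ (+ 1) (C j) {{Cpos j}} + c j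

-- prefix capacity  Σ_{j=1}^{t} C_{a_j}  (a is indexed from 0 here)
prefixCap : ∀ {m} (C : Fin m → ℕ) (a : Fin m → Fin m) → ℕ → ℕ
prefixCap {m} C a t = sumListℕ (λ j → C (a j)) (take t (allFin m))

-- Lb_1, where q : Fin m is the 0-based index of a_k, i.e. k = toℕ q + 1
Lb1 : ∀ {m} (C : Fin m → ℕ) (r : Fin m → ℚ) (a : Fin m → Fin m) (W : ℕ) (q : Fin m) → ℚ
Lb1 {m} C r a W q =
  sumListℚ (λ j → ℕtoℚ (C (a j)) * r (a j)) (take (toℕ q) (allFin m))
  + (ℕtoℚ W - ℕtoℚ (prefixCap C a (toℕ q))) * r (a q)

LPFeasible : ∀ {n m} (w : Fin n → ℕ) (C : Fin m → ℕ)
  (x : Fin n → Fin m → ℚ) (y : Fin m → ℚ) (l : Fin m → ℚ) → Set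
LPFeasible {n} {m} w C x y l =
  (∀ i → Σℚ (λ j → x i j) ≡ 1ℚ)
  × (∀ j → Σℚ (λ i → ℕtoℚ (w i) * x i j) ≡ l j)
  × (∀ j → l j ≤ ℕtoℚ (C j) * y j)
  × (∀ i j → 0ℚ ≤ x i j × x i j ≤ 1ℚ)
  × (∀ j → 0ℚ ≤ y j × y j ≤ 1ℚ)
  × (∀ j → 0ℚ ≤ l j)
  where open import Relation.Binary.PropositionalEquality using (_≡_)

LPCost : ∀ {m} (f c : Fin m → ℚ) (y l : Fin m → ℚ) → ℚ
LPCost f c y l = Σℚ (λ j → f j * y j + c j * l j)

-- Every feasible point (x, y, l) of the relaxation has
-- loads with 0 ≤ lⱼ ≤ Cⱼ and Σ lⱼ = W, and since lⱼ ≤ Cⱼyⱼ its cost is at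
-- least Σ rⱼlⱼ.  Conversely any such load vector l is realised, at cost
-- exactly Σ rⱼlⱼ, by the proportional point xᵢⱼ = lⱼ/W, yⱼ = lⱼ/Cⱼ.  So the
-- relaxation is the fractional knapsack problem "minimise Σ rⱼlⱼ subject to
-- 0 ≤ lⱼ ≤ Cⱼ, Σ lⱼ = W", which is solved by filling the bins greedily in
-- order of increasing rate: the first k − 1 bins of the sorted order are
-- filled completely and bin a_k takes the remainder.  That greedy profile has
-- objective value Lb₁, and an exchange argument shows that no other load
-- vector does better.

module Submission where

open import Defs
open import Data.Nat as ℕ using (ℕ; zero; suc; NonZero)
import Data.Nat.Properties as ℕP
open import Data.Fin as Fin using (Fin; toℕ; zero; suc)
open import Data.List using (List; []; _∷_; take; tabulate; allFin)
open import Data.Integer as ℤ using (+_)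
import Data.Integer.Properties as ℤP
open import Data.Rational as ℚ using (ℚ; 0ℚ; 1ℚ; _≤_; _+_; _*_; _-_; mkℚ; _/_)
open import Data.Rational.Properties
open import Data.Rational.Solver using (module +-*-Solver)
open +-*-Solver
open import Data.Product using (_×_; ∃-syntax; _,_; proj₁; proj₂)
open import Data.Sum using (_⊎_; inj₁; inj₂)
open import Function.Bundles using (_↔_; Inverse)
open import Relation.Binary.PropositionalEquality
open import Relation.Nullary using (yes; no)
open import Data.Empty using (⊥-elim)
import Data.Nat.Coprimality as Coprime
import Algebra.Properties.CommutativeMonoid.Sum as MonoidSum

ℕtoℚ-mkℚ : ∀ n → ℕtoℚ n ≡ mkℚ (+ n) 0 (Coprime.sym (Coprime.1-coprimeTo n))
ℕtoℚ-mkℚ n = normalize-coprime (Coprime.sym (Coprime.1-coprimeTo n))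

ℕtoℚ-+ : ∀ a b → ℕtoℚ (a ℕ.+ b) ≡ ℕtoℚ a + ℕtoℚ b
ℕtoℚ-+ a b = begin
  (+ a ℤ.+ + b) / 1
    ≡⟨ cong₂ (λ u v → (u ℤ.+ v) / 1) (sym (ℤP.*-identityʳ (+ a))) (sym (ℤP.*-identityʳ (+ b))) ⟩
  mkℚ (+ a) 0 (Coprime.sym (Coprime.1-coprimeTo a)) + mkℚ (+ b) 0 (Coprime.sym (Coprime.1-coprimeTo b))
                                 ≡⟨ sym (cong₂ _+_ (ℕtoℚ-mkℚ a) (ℕtoℚ-mkℚ b)) ⟩
  ℕtoℚ a + ℕtoℚ b                ∎
  where open ≡-Reasoning

ℕtoℚ-nonNeg : ∀ n → 0ℚ ≤ ℕtoℚ n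
ℕtoℚ-nonNeg n = nonNegative⁻¹ (ℕtoℚ n) {{normalize-nonNeg n 1}}

ℕtoℚ-mono : ∀ {a b} → a ℕ.≤ b → ℕtoℚ a ≤ ℕtoℚ b
ℕtoℚ-mono {a} {b} a≤b = subst (λ z → ℕtoℚ a ≤ ℕtoℚ z) (ℕP.m+[n∸m]≡n a≤b) (begin
  ℕtoℚ a                  ≡⟨ sym (+-identityʳ _) ⟩
  ℕtoℚ a + 0ℚ             ≤⟨ +-monoʳ-≤ (ℕtoℚ a) (ℕtoℚ-nonNeg (b ℕ.∸ a)) ⟩
  ℕtoℚ a + ℕtoℚ (b ℕ.∸ a) ≡⟨ sym (ℕtoℚ-+ a (b ℕ.∸ a)) ⟩
  ℕtoℚ (a ℕ.+ (b ℕ.∸ a))  ∎)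
  where open ≤-Reasoning

recip : (n : ℕ) .{{_ : NonZero n}} → ℚ
recip n = (+ 1) / n

recip-inverse : ∀ n .{{_ : NonZero n}} → ℕtoℚ n * recip n ≡ 1ℚ
recip-inverse (suc n) rewrite ℕtoℚ-mkℚ (suc n) | normalize-coprime {1} {n} (Coprime.1-coprimeTo (suc n)) =
  *-inverseʳ (mkℚ (+ suc n) 0 (Coprime.sym (Coprime.1-coprimeTo (suc n))))

recip-nonNeg : ∀ n .{{_ : NonZero n}} → 0ℚ ≤ recip n
recip-nonNeg n = nonNegative⁻¹ _ {{normalize-nonNeg 1 n}}

*-nonNeg : ∀ {a b} → 0ℚ ≤ a → 0ℚ ≤ b → 0ℚ ≤ a * b
*-nonNeg {a} {b} 0≤a 0≤b = subst (_≤ a * b) (*-zeroʳ a) (*-monoˡ-≤-nonNeg a {{ℚ.nonNegative 0≤a}} 0≤b)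

0≤-difference : ∀ {a b} → a ≤ b → 0ℚ ≤ b - a
0≤-difference {a} {b} a≤b = begin
  0ℚ    ≡⟨ sym (+-inverseʳ a) ⟩
  a - a ≤⟨ +-monoˡ-≤ (ℚ.- a) a≤b ⟩
  b - a ∎
  where open ≤-Reasoning

≤-fromDifference : ∀ {a b} → 0ℚ ≤ b - a → a ≤ b
≤-fromDifference {a} {b} 0≤b-a = begin
  a           ≡⟨ sym (+-identityʳ a) ⟩
  a + 0ℚ      ≤⟨ +-monoʳ-≤ a 0≤b-a ⟩
  a + (b - a) ≡⟨ solve 2 (λ a b → a :+ (b :- a) := b) refl a b ⟩
  b           ∎
  where open ≤-Reasoning

sameSign : ∀ {a b c d} → a ≤ b → c ≤ d → 0ℚ ≤ (b - a) * (d - c)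
sameSign a≤b c≤d = *-nonNeg (0≤-difference a≤b) (0≤-difference c≤d)

Σ-cong : ∀ {n} {f g : Fin n → ℚ} → (∀ i → f i ≡ g i) → Σℚ f ≡ Σℚ g
Σ-cong {zero}  f≗g = refl
Σ-cong {suc n} f≗g = cong₂ _+_ (f≗g zero) (Σ-cong (λ i → f≗g (suc i)))

Σ-+ : ∀ {n} (f g : Fin n → ℚ) → Σℚ (λ i → f i + g i) ≡ Σℚ f + Σℚ g
Σ-+ {zero}  f g = sym (+-identityʳ 0ℚ)
Σ-+ {suc n} f g rewrite Σ-+ (λ i → f (suc i)) (λ i → g (suc i)) =
  solve 4 (λ a b c d → (a :+ b) :+ (c :+ d) := (a :+ c) :+ (b :+ d)) refl
    (f zero) (g zero) (Σℚ (λ i → f (suc i))) (Σℚ (λ i → g (suc i)))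

Σ-*ˡ : ∀ {n} (k : ℚ) (f : Fin n → ℚ) → Σℚ (λ i → k * f i) ≡ k * Σℚ f
Σ-*ˡ {zero}  k f = sym (*-zeroʳ k)
Σ-*ˡ {suc n} k f rewrite Σ-*ˡ k (λ i → f (suc i)) = sym (*-distribˡ-+ k (f zero) _)

Σ-zero : ∀ {n} {f : Fin n → ℚ} → (∀ i → f i ≡ 0ℚ) → Σℚ f ≡ 0ℚ
Σ-zero {zero}  f≗0 = refl
Σ-zero {suc n} f≗0 = cong₂ _+_ (f≗0 zero) (Σ-zero (λ i → f≗0 (suc i)))

Σ-mono : ∀ {n} {f g : Fin n → ℚ} → (∀ i → f i ≤ g i) → Σℚ f ≤ Σℚ g
Σ-mono {zero}  f≤g = ≤-refl
Σ-mono {suc n} f≤g = +-mono-≤ (f≤g zero) (Σ-mono (λ i → f≤g (suc i)))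

Σ-nonNeg : ∀ {n} {f : Fin n → ℚ} → (∀ i → 0ℚ ≤ f i) → 0ℚ ≤ Σℚ f
Σ-nonNeg {n} {f} 0≤f = subst (_≤ Σℚ f) (Σ-zero {n} (λ _ → refl)) (Σ-mono 0≤f)

term≤Σ : ∀ {n} {f : Fin n → ℚ} → (∀ i → 0ℚ ≤ f i) → ∀ j → f j ≤ Σℚ f
term≤Σ {suc n} {f} 0≤f zero = subst (_≤ Σℚ f) (+-identityʳ (f zero))
  (+-monoʳ-≤ (f zero) (Σ-nonNeg (λ i → 0≤f (suc i))))
term≤Σ {suc n} {f} 0≤f (suc j) = subst (_≤ Σℚ f) (+-identityˡ (f (suc j)))
  (+-mono-≤ (0≤f zero) (term≤Σ (λ i → 0≤f (suc i)) j))

Σ-swap : ∀ {n m} (f : Fin n → Fin m → ℚ) →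
  Σℚ (λ i → Σℚ (λ j → f i j)) ≡ Σℚ (λ j → Σℚ (λ i → f i j))
Σ-swap {zero}  {m} f = sym (Σ-zero {m} {λ _ → 0ℚ} (λ _ → refl))
Σ-swap {suc n} f rewrite Σ-swap (λ i → f (suc i)) =
  sym (Σ-+ (λ j → f zero j) (λ j → Σℚ (λ i → f (suc i) j)))

Σ-monoidSum : ∀ {n} (f : Fin n → ℚ) → Σℚ f ≡ MonoidSum.sum +-0-commutativeMonoid f
Σ-monoidSum {zero}  f = refl
Σ-monoidSum {suc n} f = cong (_+_ (f zero)) (Σ-monoidSum (λ i → f (suc i)))

Σ-permute : ∀ {m} (π : Fin m ↔ Fin m) (f : Fin m → ℚ) → Σℚ (λ s → f (Inverse.to π s)) ≡ Σℚ f
Σ-permute π f = begin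
  Σℚ (λ s → f (Inverse.to π s))                              ≡⟨ Σ-monoidSum (λ s → f (Inverse.to π s)) ⟩
  MonoidSum.sum +-0-commutativeMonoid (λ s → f (Inverse.to π s)) ≡⟨ sym (MonoidSum.sum-permute +-0-commutativeMonoid f π) ⟩
  MonoidSum.sum +-0-commutativeMonoid f                      ≡⟨ sym (Σ-monoidSum f) ⟩
  Σℚ f                                                       ∎
  where open ≡-Reasoning

ℕtoℚ-Σ : ∀ {n} (w : Fin n → ℕ) → ℕtoℚ (Σℕ w) ≡ Σℚ (λ i → ℕtoℚ (w i))
ℕtoℚ-Σ {zero}  w = refl
ℕtoℚ-Σ {suc n} w = trans (ℕtoℚ-+ (w zero) _) (cong (_+_ (ℕtoℚ (w zero))) (ℕtoℚ-Σ (λ i → w (suc i))))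

ℕtoℚ-sumList : ∀ {A : Set} (g : A → ℕ) (xs : List A) →
  ℕtoℚ (sumListℕ g xs) ≡ sumListℚ (λ a → ℕtoℚ (g a)) xs
ℕtoℚ-sumList g []       = refl
ℕtoℚ-sumList g (x ∷ xs) = trans (ℕtoℚ-+ (g x) _) (cong (_+_ (ℕtoℚ (g x))) (ℕtoℚ-sumList g xs))

sumList-take-tabulate : ∀ {A : Set} {n} (g : A → ℚ) (e : Fin n → A) k →
  sumListℚ g (take k (tabulate e)) ≡ sumListℚ (λ s → g (e s)) (take k (allFin n))
sumList-take-tabulate {n = zero}  g e zero    = refl
sumList-take-tabulate {n = zero}  g e (suc k) = refl
sumList-take-tabulate {n = suc n} g e zero    = refl
sumList-take-tabulate {n = suc n} g e (suc k) = cong (_+_ (g (e zero))) (begin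
  sumListℚ g (take k (tabulate (λ s → e (suc s))))
    ≡⟨ sumList-take-tabulate g (λ s → e (suc s)) k ⟩
  sumListℚ (λ s → g (e (suc s))) (take k (allFin n))
    ≡⟨ sym (sumList-take-tabulate (λ s → g (e s)) suc k) ⟩
  sumListℚ (λ s → g (e s)) (take k (tabulate suc)) ∎)
  where open ≡-Reasoning

prefixCap-suc : ∀ {m} (C : Fin m → ℕ) (a : Fin m → Fin m) (q : Fin m) →
  prefixCap C a (suc (toℕ q)) ≡ prefixCap C a (toℕ q) ℕ.+ C (a q)
prefixCap-suc C a q = prefix-step (λ j → C (a j)) (λ s → s) q
  where
  prefix-step : ∀ {A : Set} {m} (g : A → ℕ) (e : Fin m → A) (q : Fin m) →
    sumListℕ g (take (suc (toℕ q)) (tabulate e)) ≡ sumListℕ g (take (toℕ q) (tabulate e)) ℕ.+ g (e q)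
  prefix-step g e zero    = ℕP.+-comm (g (e zero)) 0
  prefix-step g e (suc q) rewrite prefix-step g (λ s → e (suc s)) q = sym (ℕP.+-assoc (g (e zero)) _ (g (e (suc q))))

greedy : ∀ {m} (K : Fin m → ℚ) (q : Fin m) (D : ℚ) → Fin m → ℚ
greedy K zero    D zero    = D
greedy K zero    D (suc s) = 0ℚ
greedy K (suc q) D zero    = K zero
greedy K (suc q) D (suc s) = greedy (λ t → K (suc t)) q D s

greedy-cases : ∀ {m} (K : Fin m → ℚ) (q : Fin m) (D : ℚ) (s : Fin m) →
  (s Fin.< q × greedy K q D s ≡ K s) ⊎ (s ≡ q × greedy K q D s ≡ D) ⊎ (q Fin.< s × greedy K q D s ≡ 0ℚ)
greedy-cases K zero    D zero    = inj₂ (inj₁ (refl , refl))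
greedy-cases K zero    D (suc s) = inj₂ (inj₂ (ℕ.s≤s ℕ.z≤n , refl))
greedy-cases K (suc q) D zero    = inj₁ (ℕ.s≤s ℕ.z≤n , refl)
greedy-cases K (suc q) D (suc s) with greedy-cases (λ t → K (suc t)) q D s
... | inj₁ (s<q , e)        = inj₁ (ℕ.s≤s s<q , e)
... | inj₂ (inj₁ (s≡q , e)) = inj₂ (inj₁ (cong suc s≡q , e))
... | inj₂ (inj₂ (q<s , e)) = inj₂ (inj₂ (ℕ.s≤s q<s , e))

greedy-bounds : ∀ {m} (K : Fin m → ℚ) (q : Fin m) (D : ℚ) →
  (∀ s → 0ℚ ≤ K s) → 0ℚ ≤ D → D ≤ K q →
  ∀ s → 0ℚ ≤ greedy K q D s × greedy K q D s ≤ K s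
greedy-bounds K q D 0≤K 0≤D D≤Kq s with greedy-cases K q D s
... | inj₁ (_ , e)           rewrite e = 0≤K s , ≤-refl
... | inj₂ (inj₁ (refl , e)) rewrite e = 0≤D , D≤Kq
... | inj₂ (inj₂ (_ , e))    rewrite e = ≤-refl , 0≤K s

greedy-Σ : ∀ {m} (h : Fin m → ℚ → ℚ) → (∀ s → h s 0ℚ ≡ 0ℚ) →
  ∀ (K : Fin m → ℚ) q D →
  Σℚ (λ s → h s (greedy K q D s)) ≡ sumListℚ (λ s → h s (K s)) (take (toℕ q) (allFin m)) + h q D
greedy-Σ {suc m} h h0 K zero D = begin
  h zero D + Σℚ (λ s → h (suc s) 0ℚ) ≡⟨ cong (_+_ (h zero D)) (Σ-zero (λ s → h0 (suc s))) ⟩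
  h zero D + 0ℚ                      ≡⟨ +-comm (h zero D) 0ℚ ⟩
  0ℚ + h zero D                      ∎
  where open ≡-Reasoning
greedy-Σ {suc m} h h0 K (suc q) D = begin
  h zero (K zero) + Σℚ (λ s → h (suc s) (greedy (λ t → K (suc t)) q D s))
    ≡⟨ cong (_+_ (h zero (K zero))) (greedy-Σ (λ s → h (suc s)) (λ s → h0 (suc s)) (λ t → K (suc t)) q D) ⟩
  h zero (K zero) + (sumListℚ (λ s → h (suc s) (K (suc s))) (take (toℕ q) (allFin m)) + h (suc q) D)
    ≡⟨ cong (λ z → h zero (K zero) + (z + h (suc q) D))
         (sym (sumList-take-tabulate (λ s → h s (K s)) suc (toℕ q))) ⟩
  h zero (K zero) + (sumListℚ (λ s → h s (K s)) (take (toℕ q) (tabulate suc)) + h (suc q) D)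
    ≡⟨ sym (+-assoc (h zero (K zero)) _ _) ⟩
  sumListℚ (λ s → h s (K s)) (take (suc (toℕ q)) (allFin (suc m))) + h (suc q) D ∎
  where open ≡-Reasoning

exchange-identity : ∀ {m} (ρ L G : Fin m → ℚ) (p : ℚ) →
  Σℚ (λ s → L s * ρ s)
    ≡ Σℚ (λ s → G s * ρ s) + (Σℚ (λ s → (ρ s - p) * (L s - G s)) + p * (Σℚ L - Σℚ G))
exchange-identity {zero} ρ L G p =
  solve 1 (λ p → con 0ℚ := con 0ℚ :+ (con 0ℚ :+ p :* (con 0ℚ :- con 0ℚ))) refl p
exchange-identity {suc m} ρ L G p
  rewrite exchange-identity (λ s → ρ (suc s)) (λ s → L (suc s)) (λ s → G (suc s)) p =
  solve 8 (λ ρ₀ L₀ G₀ p A B SL SG →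
      L₀ :* ρ₀ :+ (A :+ (B :+ p :* (SL :- SG)))
        := (G₀ :* ρ₀ :+ A) :+ (((ρ₀ :- p) :* (L₀ :- G₀) :+ B) :+ p :* ((L₀ :+ SL) :- (G₀ :+ SG))))
    refl (ρ zero) (L zero) (G zero) p _ _ (Σℚ (λ s → L (suc s))) (Σℚ (λ s → G (suc s)))

exchange : ∀ {m} (ρ L G : Fin m → ℚ) (p : ℚ) → Σℚ L ≡ Σℚ G →
  (∀ s → 0ℚ ≤ (ρ s - p) * (L s - G s)) → Σℚ (λ s → G s * ρ s) ≤ Σℚ (λ s → L s * ρ s)
exchange ρ L G p ΣL≡ΣG sign = begin
  ΣGρ                                   ≡⟨ solve 3 (λ a g p → a := a :+ (con 0ℚ :+ p :* (g :- g))) refl ΣGρ (Σℚ G) p ⟩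
  ΣGρ + (0ℚ + p * (Σℚ G - Σℚ G))       ≡⟨ cong (λ z → ΣGρ + (0ℚ + p * (z - Σℚ G))) (sym ΣL≡ΣG) ⟩
  ΣGρ + (0ℚ + p * (Σℚ L - Σℚ G))       ≤⟨ +-monoʳ-≤ ΣGρ (+-monoˡ-≤ _ (Σ-nonNeg sign)) ⟩
  ΣGρ + (Σℚ (λ s → (ρ s - p) * (L s - G s)) + p * (Σℚ L - Σℚ G))
                                        ≡⟨ sym (exchange-identity ρ L G p) ⟩
  Σℚ (λ s → L s * ρ s)                  ∎
  where
  open ≤-Reasoning
  ΣGρ : ℚ
  ΣGρ = Σℚ (λ s → G s * ρ s)

greedy-optimal : ∀ {m} (ρ K : Fin m → ℚ) (q : Fin m) (D : ℚ) →
  (∀ s t → s Fin.≤ t → ρ s ≤ ρ t) →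
  (L : Fin m → ℚ) → (∀ s → 0ℚ ≤ L s × L s ≤ K s) → Σℚ L ≡ Σℚ (greedy K q D) →
  Σℚ (λ s → greedy K q D s * ρ s) ≤ Σℚ (λ s → L s * ρ s)
greedy-optimal ρ K q D ρ-mono L L-bounds ΣL =
  exchange ρ L (greedy K q D) (ρ q) ΣL sign
  where
  sign : ∀ s → 0ℚ ≤ (ρ s - ρ q) * (L s - greedy K q D s)
  sign s with greedy-cases K q D s
  ... | inj₁ (s<q , e) rewrite e =
    subst (0ℚ ≤_) (solve 4 (λ a b c d → (b :- a) :* (d :- c) := (a :- b) :* (c :- d)) refl (ρ s) (ρ q) (L s) (K s))
      (sameSign (ρ-mono s q (ℕP.<⇒≤ s<q)) (proj₂ (L-bounds s)))
  ... | inj₂ (inj₁ (refl , e)) =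
    subst (0ℚ ≤_) (solve 2 (λ a b → con 0ℚ := (a :- a) :* b) refl (ρ s) (L s - greedy K q D s)) ≤-refl
  ... | inj₂ (inj₂ (q<s , e)) rewrite e =
    subst (λ z → 0ℚ ≤ (ρ s - ρ q) * z) (solve 1 (λ x → x := x :- con 0ℚ) refl (L s))
      (*-nonNeg (0≤-difference (ρ-mono q s (ℕP.<⇒≤ q<s))) (proj₁ (L-bounds s)))

-- Visiting the bins in the order π, a profile G over positions becomes the
-- load vector unsort π G over bins.
unsort : ∀ {m} (π : Fin m ↔ Fin m) (G : Fin m → ℚ) → Fin m → ℚ
unsort π G j = G (Inverse.from π j)

Σ-unsort : ∀ {m} (π : Fin m ↔ Fin m) (G : Fin m → ℚ) (h : Fin m → ℚ → ℚ) →
  Σℚ (λ j → h j (unsort π G j)) ≡ Σℚ (λ s → h (Inverse.to π s) (G s))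
Σ-unsort π G h = trans (sym (Σ-permute π (λ j → h j (unsort π G j))))
  (Σ-cong (λ s → cong (λ t → h (Inverse.to π s) (G t)) (Inverse.inverseʳ π refl)))

unsort-bounds : ∀ {m} (π : Fin m ↔ Fin m) (G cap : Fin m → ℚ) →
  (∀ s → 0ℚ ≤ G s × G s ≤ cap (Inverse.to π s)) → ∀ j → 0ℚ ≤ unsort π G j × unsort π G j ≤ cap j
unsort-bounds π G cap G-bounds j =
  subst (λ k → 0ℚ ≤ unsort π G j × unsort π G j ≤ cap k) (Inverse.inverseˡ π refl) (G-bounds (Inverse.from π j))

greedy-optimal-sorted : ∀ {m} (π : Fin m ↔ Fin m) (r cap : Fin m → ℚ) (q : Fin m) (D : ℚ) →
  (∀ s t → s Fin.≤ t → r (Inverse.to π s) ≤ r (Inverse.to π t)) →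
  (L : Fin m → ℚ) → (∀ j → 0ℚ ≤ L j × L j ≤ cap j) →
  Σℚ L ≡ Σℚ (greedy (λ s → cap (Inverse.to π s)) q D) →
  Σℚ (λ s → greedy (λ s → cap (Inverse.to π s)) q D s * r (Inverse.to π s)) ≤ Σℚ (λ j → L j * r j)
greedy-optimal-sorted {m} π r cap q D sorted L L-bounds ΣL≡ΣG = begin
  Σℚ (λ s → G s * r (Inverse.to π s))
    ≤⟨ greedy-optimal (λ s → r (Inverse.to π s)) (λ s → cap (Inverse.to π s)) q D sorted
         (λ s → L (Inverse.to π s)) (λ s → L-bounds (Inverse.to π s)) ΣLπ≡ΣG ⟩
  Σℚ (λ s → L (Inverse.to π s) * r (Inverse.to π s)) ≡⟨ Σ-permute π (λ j → L j * r j) ⟩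
  Σℚ (λ j → L j * r j)                                ∎
  where
  open ≤-Reasoning
  G : Fin m → ℚ
  G = greedy (λ s → cap (Inverse.to π s)) q D
  ΣLπ≡ΣG : Σℚ (λ s → L (Inverse.to π s)) ≡ Σℚ G
  ΣLπ≡ΣG = trans (Σ-permute π L) ΣL≡ΣG

greedyLoads : ∀ {m} (C : Fin m → ℕ) (a : Fin m → Fin m) (W : ℕ) (q : Fin m) → Fin m → ℚ
greedyLoads C a W q = greedy (λ s → ℕtoℚ (C (a s))) q (ℕtoℚ W - ℕtoℚ (prefixCap C a (toℕ q)))

remainder-bounds : ∀ {P W k} → P ℕ.≤ W → W ℕ.≤ P ℕ.+ k →
  0ℚ ≤ ℕtoℚ W - ℕtoℚ P × ℕtoℚ W - ℕtoℚ P ≤ ℕtoℚ k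
remainder-bounds {P} {W} {k} P≤W W≤P+k = 0≤-difference (ℕtoℚ-mono P≤W) ,
  ≤-fromDifference (subst (0ℚ ≤_) (solve 3 (λ W P k → (P :+ k) :- W := k :- (W :- P)) refl (ℕtoℚ W) (ℕtoℚ P) (ℕtoℚ k))
    (0≤-difference (subst (ℕtoℚ W ≤_) (ℕtoℚ-+ P k) (ℕtoℚ-mono W≤P+k))))

below-least : ∀ (g : ℕ → ℕ) W k → (∀ t → W ℕ.≤ g t → suc k ℕ.≤ t) → g k ℕ.< W
below-least g W k least with W ℕ.≤? g k
... | yes W≤gk = ⊥-elim (ℕP.n≮n k (least k W≤gk))
... | no  W≰gk = ℕP.≰⇒> W≰gk

module _ {m} (C : Fin m → ℕ) (a : Fin m → Fin m) (W : ℕ) (q : Fin m) where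

  private
    K : Fin m → ℚ
    K s = ℕtoℚ (C (a s))
    P : ℕ
    P = prefixCap C a (toℕ q)

  greedyLoads-bounds : P ℕ.≤ W → W ℕ.≤ prefixCap C a (suc (toℕ q)) →
    ∀ s → 0ℚ ≤ greedyLoads C a W q s × greedyLoads C a W q s ≤ K s
  greedyLoads-bounds P≤W W≤P′ = greedy-bounds K q _ (λ s → ℕtoℚ-nonNeg (C (a s)))
    (proj₁ remainder) (proj₂ remainder)
    where
    remainder : 0ℚ ≤ ℕtoℚ W - ℕtoℚ P × ℕtoℚ W - ℕtoℚ P ≤ ℕtoℚ (C (a q))
    remainder = remainder-bounds P≤W (subst (W ℕ.≤_) (prefixCap-suc C a q) W≤P′)

  greedyLoads-total : Σℚ (greedyLoads C a W q) ≡ ℕtoℚ W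
  greedyLoads-total = begin
    Σℚ (greedyLoads C a W q)
      ≡⟨ greedy-Σ (λ _ z → z) (λ _ → refl) K q _ ⟩
    sumListℚ K (take (toℕ q) (allFin m)) + (ℕtoℚ W - ℕtoℚ P)
      ≡⟨ cong (_+ (ℕtoℚ W - ℕtoℚ P)) (sym (ℕtoℚ-sumList (λ s → C (a s)) (take (toℕ q) (allFin m)))) ⟩
    ℕtoℚ P + (ℕtoℚ W - ℕtoℚ P)
      ≡⟨ solve 2 (λ P W → P :+ (W :- P) := W) refl (ℕtoℚ P) (ℕtoℚ W) ⟩
    ℕtoℚ W ∎
    where open ≡-Reasoning

  greedyLoads-cost : ∀ (r : Fin m → ℚ) → Σℚ (λ s → greedyLoads C a W q s * r (a s)) ≡ Lb1 C r a W q
  greedyLoads-cost r = greedy-Σ (λ s z → z * r (a s)) (λ s → *-zeroˡ (r (a s))) K q _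

module _ {n m} (w : Fin n → ℕ) (C : Fin m → ℕ) where

  feasible-total-load : ∀ {x y l} → LPFeasible w C x y l → Σℚ l ≡ ℕtoℚ (Σℕ w)
  feasible-total-load {x} {l = l} (assigned , load , _) = begin
    Σℚ l                                        ≡⟨ Σ-cong (λ j → sym (load j)) ⟩
    Σℚ (λ j → Σℚ (λ i → ℕtoℚ (w i) * x i j))    ≡⟨ sym (Σ-swap (λ i j → ℕtoℚ (w i) * x i j)) ⟩
    Σℚ (λ i → Σℚ (λ j → ℕtoℚ (w i) * x i j))    ≡⟨ Σ-cong (λ i → Σ-*ˡ (ℕtoℚ (w i)) (x i)) ⟩
    Σℚ (λ i → ℕtoℚ (w i) * Σℚ (x i))            ≡⟨ Σ-cong (λ i → trans (cong (ℕtoℚ (w i) *_) (assigned i)) (*-identityʳ _)) ⟩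
    Σℚ (λ i → ℕtoℚ (w i))                       ≡⟨ sym (ℕtoℚ-Σ w) ⟩
    ℕtoℚ (Σℕ w)                                 ∎
    where open ≡-Reasoning

  feasible-load-bounds : ∀ {x y l} → LPFeasible w C x y l → ∀ j → 0ℚ ≤ l j × l j ≤ ℕtoℚ (C j)
  feasible-load-bounds {y = y} {l} (_ , _ , l≤Cy , _ , y-bounds , 0≤l) j = 0≤l j , (begin
    l j               ≤⟨ l≤Cy j ⟩
    ℕtoℚ (C j) * y j  ≤⟨ *-monoˡ-≤-nonNeg (ℕtoℚ (C j)) {{ℚ.nonNegative (ℕtoℚ-nonNeg (C j))}} (proj₂ (y-bounds j)) ⟩
    ℕtoℚ (C j) * 1ℚ   ≡⟨ *-identityʳ _ ⟩
    ℕtoℚ (C j)        ∎)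
    where open ≤-Reasoning

  module _ (Cpos : ∀ j → NonZero (C j)) (f c : Fin m → ℚ) where

    private
      r : Fin m → ℚ
      r = rate C Cpos f c

      recipC : Fin m → ℚ
      recipC j = recip (C j) {{Cpos j}}

    -- Since lⱼ ≤ Cⱼyⱼ and fⱼ ≥ 0, a feasible point costs at least Σ rⱼlⱼ.
    feasible-cost-bound : (∀ j → 0ℚ ≤ f j) → ∀ {x y l} → LPFeasible w C x y l →
      Σℚ (λ j → l j * r j) ≤ LPCost f c y l
    feasible-cost-bound 0≤f {y = y} {l} (_ , _ , l≤Cy , _) = Σ-mono bound
      where
      l/C≤y : ∀ j → recipC j * l j ≤ y j
      l/C≤y j = begin
        recipC j * l j                ≤⟨ *-monoˡ-≤-nonNeg (recipC j) {{ℚ.nonNegative (recip-nonNeg (C j) {{Cpos j}})}} (l≤Cy j) ⟩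
        recipC j * (ℕtoℚ (C j) * y j) ≡⟨ sym (*-assoc (recipC j) _ _) ⟩
        recipC j * ℕtoℚ (C j) * y j   ≡⟨ cong (_* y j) (trans (*-comm (recipC j) _) (recip-inverse (C j) {{Cpos j}})) ⟩
        1ℚ * y j                      ≡⟨ *-identityˡ (y j) ⟩
        y j                           ∎
        where open ≤-Reasoning
      bound : ∀ j → l j * r j ≤ f j * y j + c j * l j
      bound j = begin
        l j * r j                          ≡⟨ solve 4 (λ f i c l → l :* (f :* i :+ c) := f :* (i :* l) :+ c :* l) refl (f j) (recipC j) (c j) (l j) ⟩
        f j * (recipC j * l j) + c j * l j ≤⟨ +-monoˡ-≤ (c j * l j) (*-monoˡ-≤-nonNeg (f j) {{ℚ.nonNegative (0≤f j)}} (l/C≤y j)) ⟩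
        f j * y j + c j * l j              ∎
        where open ≤-Reasoning

    proportional-point : .{{_ : NonZero (Σℕ w)}} (l : Fin m → ℚ) →
      (∀ j → 0ℚ ≤ l j × l j ≤ ℕtoℚ (C j)) → Σℚ l ≡ ℕtoℚ (Σℕ w) →
      ∃[ x ] ∃[ y ] (LPFeasible w C x y l × LPCost f c y l ≡ Σℚ (λ j → l j * r j))
    proportional-point l l-bounds Σl≡W = x , y , (assigned , load , l≤Cy , x-bounds , y-bounds , 0≤l) , cost
      where
      W = Σℕ w
      x : Fin n → Fin m → ℚ
      x i j = l j * recip W
      y : Fin m → ℚ
      y j = l j * recipC j
      0≤l : ∀ j → 0ℚ ≤ l j
      0≤l j = proj₁ (l-bounds j)
      assigned : ∀ i → Σℚ (x i) ≡ 1ℚ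
      assigned i = begin
        Σℚ (λ j → l j * recip W) ≡⟨ Σ-cong (λ j → *-comm (l j) (recip W)) ⟩
        Σℚ (λ j → recip W * l j) ≡⟨ Σ-*ˡ (recip W) l ⟩
        recip W * Σℚ l           ≡⟨ cong (recip W *_) Σl≡W ⟩
        recip W * ℕtoℚ W         ≡⟨ *-comm (recip W) _ ⟩
        ℕtoℚ W * recip W         ≡⟨ recip-inverse W ⟩
        1ℚ                       ∎
        where open ≡-Reasoning
      load : ∀ j → Σℚ (λ i → ℕtoℚ (w i) * x i j) ≡ l j
      load j = begin
        Σℚ (λ i → ℕtoℚ (w i) * (l j * recip W)) ≡⟨ Σ-cong (λ i → *-comm (ℕtoℚ (w i)) _) ⟩
        Σℚ (λ i → l j * recip W * ℕtoℚ (w i))   ≡⟨ Σ-*ˡ (l j * recip W) (λ i → ℕtoℚ (w i)) ⟩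
        l j * recip W * Σℚ (λ i → ℕtoℚ (w i))   ≡⟨ cong (l j * recip W *_) (sym (ℕtoℚ-Σ w)) ⟩
        l j * recip W * ℕtoℚ W                  ≡⟨ solve 3 (λ a b c → (a :* b) :* c := a :* (c :* b)) refl (l j) (recip W) (ℕtoℚ W) ⟩
        l j * (ℕtoℚ W * recip W)                ≡⟨ cong (l j *_) (recip-inverse W) ⟩
        l j * 1ℚ                                ≡⟨ *-identityʳ (l j) ⟩
        l j                                     ∎
        where open ≡-Reasoning
      l≤Cy : ∀ j → l j ≤ ℕtoℚ (C j) * y j
      l≤Cy j = ≤-reflexive (sym (begin
        ℕtoℚ (C j) * (l j * recipC j) ≡⟨ solve 3 (λ a b c → a :* (b :* c) := b :* (a :* c)) refl (ℕtoℚ (C j)) (l j) (recipC j) ⟩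
        l j * (ℕtoℚ (C j) * recipC j) ≡⟨ cong (l j *_) (recip-inverse (C j) {{Cpos j}}) ⟩
        l j * 1ℚ                      ≡⟨ *-identityʳ (l j) ⟩
        l j                           ∎))
        where open ≡-Reasoning
      0≤x : ∀ i j → 0ℚ ≤ x i j
      0≤x i j = *-nonNeg (0≤l j) (recip-nonNeg W)
      x-bounds : ∀ i j → 0ℚ ≤ x i j × x i j ≤ 1ℚ
      x-bounds i j = 0≤x i j , subst (x i j ≤_) (assigned i) (term≤Σ (0≤x i) j)
      y-bounds : ∀ j → 0ℚ ≤ y j × y j ≤ 1ℚ
      y-bounds j = *-nonNeg (0≤l j) (recip-nonNeg (C j) {{Cpos j}}) ,
        subst (y j ≤_) (recip-inverse (C j) {{Cpos j}})
          (*-monoʳ-≤-nonNeg (recipC j) {{ℚ.nonNegative (recip-nonNeg (C j) {{Cpos j}})}} (proj₂ (l-bounds j)))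
      cost : LPCost f c y l ≡ Σℚ (λ j → l j * r j)
      cost = Σ-cong (λ j → solve 4 (λ f i c l → f :* (l :* i) :+ c :* l := l :* (f :* i :+ c)) refl
                             (f j) (recipC j) (c j) (l j))

    profile-attainable : .{{_ : NonZero (Σℕ w)}} (π : Fin m ↔ Fin m) (G : Fin m → ℚ) →
      (∀ s → 0ℚ ≤ G s × G s ≤ ℕtoℚ (C (Inverse.to π s))) → Σℚ G ≡ ℕtoℚ (Σℕ w) →
      ∃[ x ] ∃[ y ] ∃[ l ] (LPFeasible w C x y l × LPCost f c y l ≡ Σℚ (λ s → G s * r (Inverse.to π s)))
    profile-attainable π G G-bounds ΣG≡W =
      realise (proportional-point l (unsort-bounds π G (λ j → ℕtoℚ (C j)) G-bounds) Σl≡W)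
      where
      l : Fin m → ℚ
      l = unsort π G
      Σl≡W : Σℚ l ≡ ℕtoℚ (Σℕ w)
      Σl≡W = trans (Σ-unsort π G (λ _ z → z)) ΣG≡W
      realise : ∃[ x ] ∃[ y ] (LPFeasible w C x y l × LPCost f c y l ≡ Σℚ (λ j → l j * r j)) →
        ∃[ x ] ∃[ y ] ∃[ l ] (LPFeasible w C x y l × LPCost f c y l ≡ Σℚ (λ s → G s * r (Inverse.to π s)))
      realise (x , y , feasible , cost≡) = x , y , l , feasible , trans cost≡ (Σ-unsort π G (λ j z → z * r j))

proposition2 : (n m : ℕ) (w : Fin n → ℕ) (C : Fin m → ℕ) (f c : Fin m → ℚ) →
    (∀ i → 0 ℕ.< w i) →
    (∀ i i′ → Fin._≤_ i i′ → w i ℕ.≤ w i′) →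
    (Cpos : ∀ j → NonZero (C j)) →
    (∀ j → 0ℚ ≤ f j) →
    (∀ j → 0ℚ ≤ c j) →
    Σℕ w ℕ.≤ Σℕ C →
    (a : Fin m ↔ Fin m) →
    (∀ s t → Fin._≤_ s t →
      rate C Cpos f c (Inverse.to a s) ≤ rate C Cpos f c (Inverse.to a t)) →
    (q : Fin m) →
    Σℕ w ℕ.≤ prefixCap C (Inverse.to a) (suc (toℕ q)) →
    (∀ t → Σℕ w ℕ.≤ prefixCap C (Inverse.to a) t → suc (toℕ q) ℕ.≤ t) →
    ((x : Fin n → Fin m → ℚ) (y l : Fin m → ℚ) → LPFeasible w C x y l →
        Lb1 C (rate C Cpos f c) (Inverse.to a) (Σℕ w) q ≤ LPCost f c y l)
    × (∃[ x ] ∃[ y ] ∃[ l ] (LPFeasible w C x y l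
        × LPCost f c y l ≡ Lb1 C (rate C Cpos f c) (Inverse.to a) (Σℕ w) q))
proposition2 n m w C f c _ _ Cpos 0≤f _ _ a sorted q W≤prefix[q+1] least = lower , optimum
  where
  r : Fin m → ℚ
  r = rate C Cpos f c
  τ : Fin m → Fin m
  τ = Inverse.to a
  W : ℕ
  W = Σℕ w
  D : ℚ
  D = ℕtoℚ W - ℕtoℚ (prefixCap C τ (toℕ q))
  G : Fin m → ℚ
  G = greedyLoads C τ W q

  P<W : prefixCap C τ (toℕ q) ℕ.< W
  P<W = below-least (prefixCap C τ) W (toℕ q) least

  instance
    W≢0 : NonZero W
    W≢0 = ℕ.>-nonZero (ℕP.<-≤-trans (ℕ.s≤s ℕ.z≤n) P<W)

  G-bounds : ∀ s → 0ℚ ≤ G s × G s ≤ ℕtoℚ (C (τ s))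
  G-bounds = greedyLoads-bounds C τ W q (ℕP.<⇒≤ P<W) W≤prefix[q+1]

  lower : ∀ x y l → LPFeasible w C x y l → Lb1 C r τ W q ≤ LPCost f c y l
  lower x y l feasible = begin
    Lb1 C r τ W q             ≡⟨ sym (greedyLoads-cost C τ W q r) ⟩
    Σℚ (λ s → G s * r (τ s))  ≤⟨ greedy-optimal-sorted a r (λ j → ℕtoℚ (C j)) q D sorted l
                                   (feasible-load-bounds w C feasible) Σl≡ΣG ⟩
    Σℚ (λ j → l j * r j)      ≤⟨ feasible-cost-bound w C Cpos f c 0≤f feasible ⟩
    LPCost f c y l            ∎
    where
    open ≤-Reasoning
    Σl≡ΣG : Σℚ l ≡ Σℚ G
    Σl≡ΣG = trans (feasible-total-load w C feasible) (sym (greedyLoads-total C τ W q))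

  optimum : ∃[ x ] ∃[ y ] ∃[ l ] (LPFeasible w C x y l × LPCost f c y l ≡ Lb1 C r τ W q)
  optimum = rewrite-cost (profile-attainable w C Cpos f c a G G-bounds (greedyLoads-total C τ W q))
    where
    rewrite-cost : ∃[ x ] ∃[ y ] ∃[ l ] (LPFeasible w C x y l × LPCost f c y l ≡ Σℚ (λ s → G s * r (τ s))) →
      ∃[ x ] ∃[ y ] ∃[ l ] (LPFeasible w C x y l × LPCost f c y l ≡ Lb1 C r τ W q)
    rewrite-cost (x , y , l , feasible , cost≡) = x , y , l , feasible , trans cost≡ (greedyLoads-cost C τ W q r)
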